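{- Let $n\ge1$, $m\ge2$ and $p$ a prime number. Then $r_n(\mathbb{Z}/p^m\mathbb{Z})=p^{n-1}\,r_n(\mathbb{Z}/p^{m-1}\mathbb{Z})$.
   Context: For a finite commutative unitary ring $A$, $r_n(A)$ is the number of $(a_1,\dots,a_n)\in A^n$ with $K_n(a_1,\dots,a_n)=0_A$, where the continuants are defined by $K_{ -1}:=0_A$, $K_0:=1_A$, and for $i\ge1$, $K_i(X_1,\dots,X_i)$ is the determinant of the $i\times i$ tridiagonal matrix with diagonal $X_1,\dots,X_i$ and all entries on the sub- and super-diagonal equal to $1_A$. -}

module Defs where

open import Data.Nat using (ℕ; zero; suc; _+_; _*_; _∸_)
open import Data.Nat.DivMod using (_mod_)
open import Data.Fin using (Fin; toℕ) renaming (zero to fzero)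
import Data.Fin as Fin
open import Data.Vec using (Vec; []; _∷_)
open import Data.List using (List; []; _∷_; concatMap; map; filter; length; allFin)
open import Data.List using () renaming (allFin to allFinL)

module ZMod (k : ℕ) where
  Zn : Set
  Zn = Fin (suc k)

  0ₘ : Zn
  0ₘ = 0 mod suc k

  1ₘ : Zn
  1ₘ = 1 mod suc k

  _+ₘ_ : Zn → Zn → Zn
  a +ₘ b = (toℕ a + toℕ b) mod suc k

  _*ₘ_ : Zn → Zn → Zn
  a *ₘ b = (toℕ a * toℕ b) mod suc k

  -ₘ_ : Zn → Zn
  -ₘ a = (suc k ∸ toℕ a) mod suc k

  _-ₘ_ : Zn → Zn → Zn
  a -ₘ b = a +ₘ (-ₘ b)

  -- Continuants via the tridiagonal-determinant recurrence
  --   K_{-1} = 0, K_0 = 1, K_i = X_i K_{i-1} - K_{i-2}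
  -- (cofactor expansion along the last row of the tridiagonal matrix with
  --  diagonal X_1..X_i and all off-diagonal entries 1).
  -- Kaux k₂ k₁ as : given K_{i-2} = k₂, K_{i-1} = k₁, consume X_i, X_{i+1}, ...
  Kaux : ∀ {n} → Zn → Zn → Vec Zn n → Zn
  Kaux k₂ k₁ []       = k₁
  Kaux k₂ k₁ (a ∷ as) = Kaux k₁ ((a *ₘ k₁) -ₘ k₂) as

  K : ∀ {n} → Vec Zn n → Zn
  K = Kaux 0ₘ 1ₘ

  tuples : (n : ℕ) → List (Vec Zn n)
  tuples zero    = [] ∷ []
  tuples (suc n) = concatMap (λ a → map (a ∷_) (tuples n)) (allFinL (suc k))

  rₖ : ℕ → ℕ
  rₖ n = length (filter (λ v → K v Fin.≟ 0ₘ) (tuples n))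

-- r n N = r_n(ℤ/Nℤ) for N ≥ 1.  (The clause N = 0 is a dummy: ℤ/0ℤ = ℤ is
-- infinite and r is never applied to it in the statement, since p^m ≥ 1.)
r : ℕ → ℕ → ℕ
r n zero    = 0
r n (suc k) = ZMod.rₖ k n

module Submission where

-- Over ℤ, r_n(ℤ/Nℤ) counts the a ∈ {0,…,N-1}ⁿ with N ∣ Kₙ(a). Let N = pM with p ∣ M. Starting
-- from (K₋₁ , K₀) = (0 , 1), the recurrence Kᵢ = aᵢ Kᵢ₋₁ - Kᵢ₋₂ never reaches a pair (Kᵢ₋₁ , Kᵢ)
-- with p dividing both entries. Replacing the last entry aₙ by aₙ + tM adds tM Kₙ₋₁ to Kₙ, and
-- p ∤ Kₙ₋₁ as soon as M ∣ Kₙ; so among the p lifts of aₙ from ℤ/M to ℤ/pM exactly one gives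
-- pM ∣ Kₙ when M ∣ Kₙ, and none otherwise. Every earlier entry ranges over p times as many values,
-- while the count for the entries after it depends on it only modulo M: a factor p each.

open import Defs
import Algebra.Properties.CommutativeSemigroup as CommutativeSemigroupProperties
open import Data.Fin as Fin using (toℕ)
open import Data.Fin.Properties using (toℕ-fromℕ<; toℕ<n; toℕ-injective)
open import Data.Integer as ℤ using (ℤ; +_; -_; _-_; 0ℤ; 1ℤ; _%ℕ_; _/ℕ_)
open import Data.Integer.DivMod using (a≡a%ℕn+[a/ℕn]*n; n%ℕd<d)
open import Data.Integer.Divisibility.Signed
  using (_∣_; divides; _∣?_; ∣-refl; ∣-trans; ∣m∣n⇒∣m+n; ∣m∣n⇒∣m-n; ∣m+n∣n⇒∣m; ∣m+n∣m⇒∣n;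
         ∣m⇒∣-m; ∣n⇒∣m*n; *-cancelʳ-∣; *-monoˡ-∣; ∣⇒∣ᵤ; ∣ᵤ⇒∣; m∣∣m∣)
import Data.Integer.Properties as ℤₚ
open import Data.Integer.Tactic.RingSolver using (solve-∀)
open import Data.List using (List; []; _∷_; _++_; map; filter; length; concatMap; tabulate; allFin)
open import Data.List.Properties using (filter-++; length-++; map-tabulate; map-cong)
open import Data.Nat using (ℕ; zero; suc; _+_; _*_; _^_; _∸_; _≤_; _<_; z<s; s<s; s≤s; NonZero)
open import Data.Nat.Coprimality using (Coprime; coprime-Bézout)
open import Data.Nat.DivMod using (_%_; m%n<n; %-distribˡ-+)
open import Data.Nat.Divisibility using (∣⇒≤; ∣1⇒≡1; m∣m*n) renaming (_∣_ to _∣ℕ_)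
open import Data.Nat.GCD using (module Bézout)
open import Data.Nat.ListAction using (sum)
open import Data.Nat.Primality
  using (Prime; ¬prime[1]; euclidsLemma; prime⇒irreducible; prime⇒nonZero)
import Data.Nat.Properties as ℕₚ
open import Data.Product using (∃-syntax; ∃₂; _×_; _,_)
open import Data.Sum using (inj₁; inj₂; [_,_]′)
open import Data.Vec using (Vec; []; _∷_)
open import Function using (_∘_; id)
open import Relation.Binary.PropositionalEquality
  using (_≡_; _≗_; refl; sym; trans; cong; cong₂; subst; subst₂; module ≡-Reasoning)
open import Relation.Nullary using (Dec; yes; no; ¬_; contradiction)
open import Relation.Unary using (Decidable)

open CommutativeSemigroupProperties ℕₚ.+-commutativeSemigroup
  using () renaming (interchange to +-interchange)
open CommutativeSemigroupProperties ℕₚ.*-commutativeSemigroup using (x∙yz≈yx∙z)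
open ≡-Reasoning

∑ : ℕ → (ℕ → ℕ) → ℕ
∑ zero    f = 0
∑ (suc n) f = f 0 + ∑ n (f ∘ suc)

syntax ∑ n (λ i → e) = ∑[ i < n ] e

∑-cong : ∀ n {f g : ℕ → ℕ} → f ≗ g → ∑ n f ≡ ∑ n g
∑-cong zero    f≗g = refl
∑-cong (suc n) f≗g = cong₂ _+_ (f≗g 0) (∑-cong n (f≗g ∘ suc))

∑-+ : ∀ n (f g : ℕ → ℕ) → ∑[ i < n ] (f i + g i) ≡ ∑ n f + ∑ n g
∑-+ zero    f g = refl
∑-+ (suc n) f g =
  trans (cong (_+_ (f 0 + g 0)) (∑-+ n (f ∘ suc) (g ∘ suc))) (+-interchange (f 0) (g 0) _ _)

∑-distribˡ : ∀ n c (f : ℕ → ℕ) → ∑[ i < n ] (c * f i) ≡ c * ∑ n f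
∑-distribˡ zero    c f = sym (ℕₚ.*-zeroʳ c)
∑-distribˡ (suc n) c f =
  trans (cong (_+_ (c * f 0)) (∑-distribˡ n c (f ∘ suc))) (sym (ℕₚ.*-distribˡ-+ c (f 0) _))

∑-const : ∀ n c → ∑[ _ < n ] c ≡ n * c
∑-const zero    c = refl
∑-const (suc n) c = cong (_+_ c) (∑-const n c)

∑-split : ∀ m n (f : ℕ → ℕ) → ∑ (m + n) f ≡ ∑ m f + ∑[ i < n ] f (m + i)
∑-split zero    n f = refl
∑-split (suc m) n f =
  trans (cong (_+_ (f 0)) (∑-split m n (f ∘ suc))) (sym (ℕₚ.+-assoc (f 0) _ _))

∑-by-residue : ∀ p M (f : ℕ → ℕ) → ∑ (p * M) f ≡ ∑[ b < M ] ∑[ t < p ] f (t * M + b)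
∑-by-residue zero    M f = sym (trans (∑-const M 0) (ℕₚ.*-zeroʳ M))
∑-by-residue (suc p) M f = begin
  ∑ (M + p * M) f
    ≡⟨ ∑-split M (p * M) f ⟩
  ∑ M f + ∑[ i < p * M ] f (M + i)
    ≡⟨ cong (_+_ (∑ M f)) (∑-by-residue p M (f ∘ (_+_ M))) ⟩
  ∑ M f + ∑[ b < M ] ∑[ t < p ] f (M + (t * M + b))
    ≡⟨ ∑-+ M f _ ⟨
  ∑[ b < M ] (f b + ∑[ t < p ] f (M + (t * M + b)))
    ≡⟨ ∑-cong M (λ b → cong (_+_ (f b)) (∑-cong p (λ t → cong f (ℕₚ.+-assoc M (t * M) b)))) ⟨
  ∑[ b < M ] ∑[ t < suc p ] f (t * M + b)
    ∎

∑-periodic : ∀ p M (f : ℕ → ℕ) → (∀ t b → f (t * M + b) ≡ f b) → ∑ (p * M) f ≡ p * ∑ M f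
∑-periodic p M f periodic = begin
  ∑ (p * M) f                          ≡⟨ ∑-by-residue p M f ⟩
  ∑[ b < M ] ∑[ t < p ] f (t * M + b)  ≡⟨ ∑-cong M (λ b → trans (∑-cong p (λ t → periodic t b))
                                                                (∑-const p (f b))) ⟩
  ∑[ b < M ] (p * f b)                 ≡⟨ ∑-distribˡ M p f ⟩
  p * ∑ M f                            ∎

𝟙 : {P : Set} → Dec P → ℕ
𝟙 (yes _) = 1
𝟙 (no  _) = 0

𝟙-yes : {P : Set} (P? : Dec P) → P → 𝟙 P? ≡ 1
𝟙-yes (yes _) _ = refl
𝟙-yes (no ¬p) p = contradiction p ¬p

𝟙-no : {P : Set} (P? : Dec P) → ¬ P → 𝟙 P? ≡ 0
𝟙-no (yes p) ¬p = contradiction p ¬p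
𝟙-no (no _)  _  = refl

𝟙-cong : {P Q : Set} (P? : Dec P) (Q? : Dec Q) → (P → Q) → (Q → P) → 𝟙 P? ≡ 𝟙 Q?
𝟙-cong (yes p) Q? P→Q _   = sym (𝟙-yes Q? (P→Q p))
𝟙-cong (no ¬p) Q? _   Q→P = sym (𝟙-no Q? (¬p ∘ Q→P))

∑-𝟙-none : ∀ n {P : ℕ → Set} (P? : Decidable P) → (∀ t → t < n → ¬ P t) →
           ∑[ t < n ] 𝟙 (P? t) ≡ 0
∑-𝟙-none zero    P? none = refl
∑-𝟙-none (suc n) P? none =
  cong₂ _+_ (𝟙-no (P? 0) (none 0 z<s))
            (∑-𝟙-none n (P? ∘ suc) (λ t t<n → none (suc t) (s<s t<n)))

∑-𝟙-unique : ∀ n {P : ℕ → Set} (P? : Decidable P) {t₀} → t₀ < n → P t₀ →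
             (∀ t → t < n → P t → t ≡ t₀) → ∑[ t < n ] 𝟙 (P? t) ≡ 1
∑-𝟙-unique (suc n) P? {zero} _ P0 unique =
  cong₂ _+_ (𝟙-yes (P? 0) P0)
            (∑-𝟙-none n (P? ∘ suc) (λ t t<n → ℕₚ.1+n≢0 ∘ unique (suc t) (s<s t<n)))
∑-𝟙-unique (suc n) P? {suc t₀} (s<s t₀<n) Pt₀ unique =
  cong₂ _+_ (𝟙-no (P? 0) (ℕₚ.0≢1+n ∘ unique 0 z<s))
            (∑-𝟙-unique n (P? ∘ suc) t₀<n Pt₀
                        (λ t t<n → ℕₚ.suc-injective ∘ unique (suc t) (s<s t<n)))

length-filter-∷ : ∀ {A : Set} {P : A → Set} (P? : Decidable P) x xs →
                  length (filter P? (x ∷ xs)) ≡ 𝟙 (P? x) + length (filter P? xs)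
length-filter-∷ P? x xs with P? x
... | yes _ = refl
... | no  _ = refl

module _ {A : Set} {P : A → Set} (P? : Decidable P) where

  length-filter-concatMap : ∀ {B : Set} (f : B → List A) xs →
    length (filter P? (concatMap f xs)) ≡ sum (map (length ∘ filter P? ∘ f) xs)
  length-filter-concatMap f []       = refl
  length-filter-concatMap f (x ∷ xs) = begin
    length (filter P? (f x ++ concatMap f xs))
      ≡⟨ cong length (filter-++ P? (f x) _) ⟩
    length (filter P? (f x) ++ filter P? (concatMap f xs))
      ≡⟨ length-++ (filter P? (f x)) ⟩
    length (filter P? (f x)) + length (filter P? (concatMap f xs))
      ≡⟨ cong (_+_ (length (filter P? (f x)))) (length-filter-concatMap f xs) ⟩
    sum (map (length ∘ filter P? ∘ f) (x ∷ xs))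
      ∎

  length-filter-map : ∀ {B : Set} (g : B → A) ys →
                      length (filter P? (map g ys)) ≡ length (filter (P? ∘ g) ys)
  length-filter-map g []       = refl
  length-filter-map g (y ∷ ys) = begin
    length (filter P? (g y ∷ map g ys))           ≡⟨ length-filter-∷ P? (g y) (map g ys) ⟩
    𝟙 (P? (g y)) + length (filter P? (map g ys))  ≡⟨ cong (_+_ (𝟙 (P? (g y)))) (length-filter-map g ys) ⟩
    𝟙 (P? (g y)) + length (filter (P? ∘ g) ys)    ≡⟨ length-filter-∷ (P? ∘ g) y ys ⟨
    length (filter (P? ∘ g) (y ∷ ys))             ∎

sum-map-allFin : ∀ n (h : ℕ → ℕ) → sum (map (h ∘ toℕ) (allFin n)) ≡ ∑ n h
sum-map-allFin n h = trans (cong sum (map-tabulate {n = n} id (h ∘ toℕ))) (sum-tabulate n h)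
  where
  sum-tabulate : ∀ n (h : ℕ → ℕ) → sum (tabulate {n = n} (h ∘ toℕ)) ≡ ∑ n h
  sum-tabulate zero    h = refl
  sum-tabulate (suc n) h = cong (_+_ (h 0)) (sum-tabulate n (h ∘ suc))

∣∧<⇒≡0 : ∀ {d m} → d ∣ℕ m → m < d → m ≡ 0
∣∧<⇒≡0 {m = zero}  _   _   = refl
∣∧<⇒≡0 {m = suc m} d∣m m<d = contradiction (∣⇒≤ d∣m) (ℕₚ.<⇒≱ m<d)

pos-Bézout : ∀ x y m n → 1 + y * n ≡ x * m → 1ℤ ℤ.+ + y ℤ.* + n ≡ + x ℤ.* + m
pos-Bézout x y m n eq = begin
  1ℤ ℤ.+ + y ℤ.* + n  ≡⟨ cong (ℤ._+_ 1ℤ) (ℤₚ.pos-* y n) ⟨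
  1ℤ ℤ.+ + (y * n)    ≡⟨ ℤₚ.pos-+ 1 (y * n) ⟨
  + (1 + y * n)       ≡⟨ cong +_ eq ⟩
  + (x * m)           ≡⟨ ℤₚ.pos-* x m ⟩
  + x ℤ.* + m         ∎

ℤ-Bézout : ∀ {m n} → Bézout.Identity 1 m n → ∃₂ λ a b → a ℤ.* + m ℤ.+ b ℤ.* + n ≡ 1ℤ
ℤ-Bézout {m} {n} (Bézout.+- x y eq) = + x , - + y , (begin
  + x ℤ.* + m ℤ.+ - + y ℤ.* + n         ≡⟨ cong (ℤ._+ - + y ℤ.* + n) (pos-Bézout x y m n eq) ⟨
  1ℤ ℤ.+ + y ℤ.* + n ℤ.+ - + y ℤ.* + n  ≡⟨ cancel (+ y) (+ n) ⟩
  1ℤ                                    ∎)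
  where
  cancel : ∀ y n → 1ℤ ℤ.+ y ℤ.* n ℤ.+ - y ℤ.* n ≡ 1ℤ
  cancel = solve-∀
ℤ-Bézout {m} {n} (Bézout.-+ x y eq) = - + x , + y , (begin
  - + x ℤ.* + m ℤ.+ + y ℤ.* + n           ≡⟨ cong (ℤ._+_ (- + x ℤ.* + m)) (pos-Bézout y x n m eq) ⟨
  - + x ℤ.* + m ℤ.+ (1ℤ ℤ.+ + x ℤ.* + m)  ≡⟨ cancel (+ x) (+ m) ⟩
  1ℤ                                      ∎)
  where
  cancel : ∀ x m → - x ℤ.* m ℤ.+ (1ℤ ℤ.+ x ℤ.* m) ≡ 1ℤ
  cancel = solve-∀

infix 4 _≡_mod_
_≡_mod_ : ℤ → ℤ → ℕ → Set
x ≡ y mod N = ∃[ q ] x ≡ y ℤ.+ q ℤ.* + N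

≡mod-refl : ∀ {N} x → x ≡ x mod N
≡mod-refl x = 0ℤ , sym (ℤₚ.+-identityʳ x)

≡mod-trans : ∀ {N x y z} → x ≡ y mod N → y ≡ z mod N → x ≡ z mod N
≡mod-trans {N} {z = z} (i , refl) (j , refl) = j ℤ.+ i , reassociate z j i (+ N)
  where
  reassociate : ∀ z j i N → z ℤ.+ j ℤ.* N ℤ.+ i ℤ.* N ≡ z ℤ.+ (j ℤ.+ i) ℤ.* N
  reassociate = solve-∀

%ℕ-≡mod : ∀ x N .{{_ : NonZero N}} → + (x %ℕ N) ≡ x mod N
%ℕ-≡mod x N = - (x /ℕ N) , (begin
  + (x %ℕ N)
    ≡⟨ cancel (+ (x %ℕ N)) (x /ℕ N) (+ N) ⟩
  + (x %ℕ N) ℤ.+ (x /ℕ N) ℤ.* + N ℤ.+ - (x /ℕ N) ℤ.* + N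
    ≡⟨ cong (ℤ._+ - (x /ℕ N) ℤ.* + N) (a≡a%ℕn+[a/ℕn]*n x N) ⟨
  x ℤ.+ - (x /ℕ N) ℤ.* + N
    ∎)
  where
  cancel : ∀ r q N → r ≡ r ℤ.+ q ℤ.* N ℤ.+ - q ℤ.* N
  cancel = solve-∀

root-from-inverse : ∀ {N} .{{_ : NonZero N}} {c v} → c ℤ.* v ≡ 1ℤ mod N →
                    ∀ s → + N ∣ s ℤ.+ + ((- s ℤ.* c) %ℕ N) ℤ.* v
root-from-inverse {N} {c} {v} (k , cv≡1+kN) s with %ℕ-≡mod (- s ℤ.* c) N
... | q , t≡-sc+qN = divides (q ℤ.* v - s ℤ.* k) (begin
  s ℤ.+ + ((- s ℤ.* c) %ℕ N) ℤ.* v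
    ≡⟨ cong (λ x → s ℤ.+ x ℤ.* v) t≡-sc+qN ⟩
  s ℤ.+ (- s ℤ.* c ℤ.+ q ℤ.* + N) ℤ.* v
    ≡⟨ expand s c v q (+ N) ⟩
  s ℤ.+ - s ℤ.* (c ℤ.* v) ℤ.+ q ℤ.* v ℤ.* + N
    ≡⟨ cong (λ x → s ℤ.+ - s ℤ.* x ℤ.+ q ℤ.* v ℤ.* + N) cv≡1+kN ⟩
  s ℤ.+ - s ℤ.* (1ℤ ℤ.+ k ℤ.* + N) ℤ.+ q ℤ.* v ℤ.* + N
    ≡⟨ collect s k v q (+ N) ⟩
  (q ℤ.* v - s ℤ.* k) ℤ.* + N
    ∎)
  where
  expand : ∀ s c v q N →
           s ℤ.+ (- s ℤ.* c ℤ.+ q ℤ.* N) ℤ.* v ≡ s ℤ.+ - s ℤ.* (c ℤ.* v) ℤ.+ q ℤ.* v ℤ.* N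
  expand = solve-∀
  collect : ∀ s k v q N →
            s ℤ.+ - s ℤ.* (1ℤ ℤ.+ k ℤ.* N) ℤ.+ q ℤ.* v ℤ.* N ≡ (q ℤ.* v - s ℤ.* k) ℤ.* N
  collect = solve-∀

countZeros : ℕ → ℕ → ℤ → ℤ → ℕ
countZeros N zero    u v = 𝟙 (+ N ∣? v)
countZeros N (suc n) u v = ∑[ a < N ] countZeros N n v (+ a ℤ.* v - u)

countZeros-cong : ∀ N n {u u′ v v′} → u ≡ u′ mod N → v ≡ v′ mod N →
                  countZeros N n u v ≡ countZeros N n u′ v′
countZeros-cong N zero {v′ = v′} _ (j , refl) =
  𝟙-cong (+ N ∣? _) (+ N ∣? v′) (λ N∣ → ∣m+n∣n⇒∣m N∣ N∣jN) (λ N∣v′ → ∣m∣n⇒∣m+n N∣v′ N∣jN)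
  where
  N∣jN : + N ∣ j ℤ.* + N
  N∣jN = ∣n⇒∣m*n j ∣-refl
countZeros-cong N (suc n) {u′ = u′} {v′ = v′} (i , refl) (j , refl) =
  ∑-cong N (λ a → countZeros-cong N n (j , refl) (+ a ℤ.* j - i , shift (+ a) v′ j (+ N) u′ i))
  where
  shift : ∀ a v j N u i →
          a ℤ.* (v ℤ.+ j ℤ.* N) - (u ℤ.+ i ℤ.* N) ≡ (a ℤ.* v - u) ℤ.+ (a ℤ.* j - i) ℤ.* N
  shift = solve-∀

block-shift : ∀ t M b (v u : ℤ) → + (t * M + b) ℤ.* v - u ≡ (+ b ℤ.* v - u) ℤ.+ + t ℤ.* v ℤ.* + M
block-shift t M b v u = begin
  + (t * M + b) ℤ.* v - u                ≡⟨ cong (λ x → x ℤ.* v - u) (ℤₚ.pos-+ (t * M) b) ⟩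
  (+ (t * M) ℤ.+ + b) ℤ.* v - u          ≡⟨ cong (λ x → (x ℤ.+ + b) ℤ.* v - u) (ℤₚ.pos-* t M) ⟩
  (+ t ℤ.* + M ℤ.+ + b) ℤ.* v - u        ≡⟨ expand (+ t) (+ M) (+ b) v u ⟩
  (+ b ℤ.* v - u) ℤ.+ + t ℤ.* v ℤ.* + M  ∎
  where
  expand : ∀ t M b v u → (t ℤ.* M ℤ.+ b) ℤ.* v - u ≡ (b ℤ.* v - u) ℤ.+ t ℤ.* v ℤ.* M
  expand = solve-∀

Unimodular : ℕ → ℤ → ℤ → Set
Unimodular p u v = ¬ (+ p ∣ u × + p ∣ v)

unimodular⇒∤ : ∀ {p u v} → Unimodular p u v → ∀ a → + p ∣ + a ℤ.* v - u → ¬ + p ∣ v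
unimodular⇒∤ {p} {u} {v} unimodular a p∣av-u p∣v = unimodular (p∣u , p∣v)
  where
  p∣u : + p ∣ u
  p∣u = subst (+ p ∣_) (ℤₚ.neg-involutive u)
              (∣m⇒∣-m (∣m+n∣m⇒∣n p∣av-u (∣n⇒∣m*n (+ a) p∣v)))

unimodular-step : ∀ {p u v} → Unimodular p u v → ∀ a → Unimodular p v (+ a ℤ.* v - u)
unimodular-step unimodular a (p∣v , p∣av-u) = unimodular⇒∤ unimodular a p∣av-u p∣v

module _ {p} (isPrime : Prime p) where

  private
    instance
      p≢0 : NonZero p
      p≢0 = prime⇒nonZero isPrime

  unimodular-0-1 : Unimodular p 0ℤ 1ℤ
  unimodular-0-1 (_ , p∣1) = ¬prime[1] (subst Prime (∣1⇒≡1 (∣⇒∣ᵤ p∣1)) isPrime)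

  ∤⇒coprime : ∀ {w} → ¬ p ∣ℕ w → Coprime p w
  ∤⇒coprime p∤w (d∣p , d∣w) with prime⇒irreducible isPrime d∣p
  ... | inj₁ d≡1  = d≡1
  ... | inj₂ refl = contradiction d∣w p∤w

  p∣d*v⇒p∣d : ∀ d {v} → ¬ + p ∣ v → + p ∣ + d ℤ.* v → p ∣ℕ d
  p∣d*v⇒p∣d d {v} p∤v p∣dv =
    [ id , (λ p∣∣v∣ → contradiction (∣ᵤ⇒∣ p∣∣v∣) p∤v) ]′
      (euclidsLemma d ℤ.∣ v ∣ isPrime (subst (p ∣ℕ_) (ℤₚ.abs-* (+ d) v) (∣⇒∣ᵤ p∣dv)))

  inverse-mod : ∀ {v} → ¬ + p ∣ v → ∃[ c ] c ℤ.* v ≡ 1ℤ mod p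
  inverse-mod {v} p∤v with m∣∣m∣ {v} | ℤ-Bézout (coprime-Bézout (∤⇒coprime (p∤v ∘ ∣ᵤ⇒∣)))
  ... | divides σ ∣v∣≡σv | a , b , ap+b∣v∣≡1 = b ℤ.* σ , - a , (begin
    b ℤ.* σ ℤ.* v                                   ≡⟨ ℤₚ.*-assoc b σ v ⟩
    b ℤ.* (σ ℤ.* v)                                 ≡⟨ cong (b ℤ.*_) ∣v∣≡σv ⟨
    b ℤ.* + ℤ.∣ v ∣                                 ≡⟨ isolate a b (+ p) (+ ℤ.∣ v ∣) ⟩
    a ℤ.* + p ℤ.+ b ℤ.* + ℤ.∣ v ∣ ℤ.+ - a ℤ.* + p   ≡⟨ cong (ℤ._+ - a ℤ.* + p) ap+b∣v∣≡1 ⟩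
    1ℤ ℤ.+ - a ℤ.* + p                              ∎)
    where
    isolate : ∀ a b p w → b ℤ.* w ≡ a ℤ.* p ℤ.+ b ℤ.* w ℤ.+ - a ℤ.* p
    isolate = solve-∀

  linear-root : ∀ {v} → ¬ + p ∣ v → ∀ s → ∃[ t ] t < p × + p ∣ s ℤ.+ + t ℤ.* v
  linear-root p∤v s = let (c , cv≡1) = inverse-mod p∤v in
    (- s ℤ.* c) %ℕ p , n%ℕd<d (- s ℤ.* c) p , root-from-inverse cv≡1 s

  linear-root-unique : ∀ {v} → ¬ + p ∣ v → ∀ s {t t′} → t < p → t′ < p →
                       + p ∣ s ℤ.+ + t ℤ.* v → + p ∣ s ℤ.+ + t′ ℤ.* v → t ≡ t′
  linear-root-unique {v} p∤v s {t} {t′} t<p t′<p p∣s+tv p∣s+t′v =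
    [ (λ t≤t′ → ordered t≤t′ t′<p p∣s+tv p∣s+t′v)
    , (λ t′≤t → sym (ordered t′≤t t<p p∣s+t′v p∣s+tv)) ]′ (ℕₚ.≤-total t t′)
    where
    difference : ∀ s t d v → s ℤ.+ (t ℤ.+ d) ℤ.* v - (s ℤ.+ t ℤ.* v) ≡ d ℤ.* v
    difference = solve-∀
    ordered : ∀ {t t′} → t ≤ t′ → t′ < p →
              + p ∣ s ℤ.+ + t ℤ.* v → + p ∣ s ℤ.+ + t′ ℤ.* v → t ≡ t′
    ordered {t} t≤t′ t′<p p∣s+tv p∣s+t′v with ℕₚ.m≤n⇒∃[o]m+o≡n t≤t′
    ... | d , refl = sym (trans (cong (_+_ t) d≡0) (ℕₚ.+-identityʳ t))
      where
      p∣dv : + p ∣ + d ℤ.* v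
      p∣dv = subst (+ p ∣_)
                   (trans (cong (λ x → s ℤ.+ x ℤ.* v - (s ℤ.+ + t ℤ.* v)) (ℤₚ.pos-+ t d))
                          (difference s (+ t) (+ d) v))
                   (∣m∣n⇒∣m-n p∣s+t′v p∣s+tv)
      d≡0 : d ≡ 0
      d≡0 = ∣∧<⇒≡0 (p∣d*v⇒p∣d d p∤v p∣dv) (ℕₚ.≤-<-trans (ℕₚ.m≤n+m d t) t′<p)

  ∑-linear-roots : ∀ {v} → ¬ + p ∣ v → ∀ s → ∑[ t < p ] 𝟙 (+ p ∣? s ℤ.+ + t ℤ.* v) ≡ 1
  ∑-linear-roots {v} p∤v s = let (t₀ , t₀<p , root) = linear-root p∤v s in
    ∑-𝟙-unique p (λ t → + p ∣? s ℤ.+ + t ℤ.* v) t₀<p root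
      (λ t t<p root′ → linear-root-unique p∤v s t<p t₀<p root′ root)

  ∑-lifts : ∀ M .{{_ : NonZero M}} {x v} → (+ M ∣ x → ¬ + p ∣ v) →
            ∑[ t < p ] 𝟙 (+ (p * M) ∣? x ℤ.+ + t ℤ.* v ℤ.* + M) ≡ 𝟙 (+ M ∣? x)
  ∑-lifts M {x} {v} M∣x⇒p∤v with + M ∣? x
  ... | no M∤x = ∑-𝟙-none p (λ t → + (p * M) ∣? x ℤ.+ + t ℤ.* v ℤ.* + M)
                   (λ t _ pM∣ → M∤x (∣m+n∣n⇒∣m (∣-trans M∣pM pM∣) (∣n⇒∣m*n (+ t ℤ.* v) ∣-refl)))
    where
    M∣pM : + M ∣ + (p * M)
    M∣pM = divides (+ p) (ℤₚ.pos-* p M)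
  ... | yes M∣x@(divides s refl) =
    trans (∑-cong p (λ t → 𝟙-cong _ _ (cancel t) (uncancel t))) (∑-linear-roots (M∣x⇒p∤v M∣x) s)
    where
    factor : ∀ t → s ℤ.* + M ℤ.+ + t ℤ.* v ℤ.* + M ≡ (s ℤ.+ + t ℤ.* v) ℤ.* + M
    factor t = sym (ℤₚ.*-distribʳ-+ (+ M) s (+ t ℤ.* v))
    cancel : ∀ t → + (p * M) ∣ s ℤ.* + M ℤ.+ + t ℤ.* v ℤ.* + M → + p ∣ s ℤ.+ + t ℤ.* v
    cancel t = *-cancelʳ-∣ (+ M) ∘ subst₂ _∣_ (ℤₚ.pos-* p M) (factor t)
    uncancel : ∀ t → + p ∣ s ℤ.+ + t ℤ.* v → + (p * M) ∣ s ℤ.* + M ℤ.+ + t ℤ.* v ℤ.* + M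
    uncancel t = subst₂ _∣_ (sym (ℤₚ.pos-* p M)) (sym (factor t)) ∘ *-monoˡ-∣ (+ M)

  module _ {M} .{{_ : NonZero M}} (p∣M : p ∣ℕ M) where

    countZeros-lift : ∀ n {u v} → Unimodular p u v →
                      countZeros (p * M) (suc n) u v ≡ p ^ n * countZeros M (suc n) u v
    countZeros-lift zero {u} {v} unimodular = begin
      ∑[ a < p * M ] 𝟙 (+ (p * M) ∣? + a ℤ.* v - u)
        ≡⟨ ∑-by-residue p M _ ⟩
      ∑[ b < M ] ∑[ t < p ] 𝟙 (+ (p * M) ∣? + (t * M + b) ℤ.* v - u)
        ≡⟨ ∑-cong M (λ b → ∑-cong p (λ t → cong (λ x → 𝟙 (+ (p * M) ∣? x)) (block-shift t M b v u))) ⟩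
      ∑[ b < M ] ∑[ t < p ] 𝟙 (+ (p * M) ∣? (+ b ℤ.* v - u) ℤ.+ + t ℤ.* v ℤ.* + M)
        ≡⟨ ∑-cong M (λ b → ∑-lifts M (λ M∣ → unimodular⇒∤ unimodular b (∣-trans (∣ᵤ⇒∣ p∣M) M∣))) ⟩
      ∑[ b < M ] 𝟙 (+ M ∣? + b ℤ.* v - u)
        ≡⟨ ℕₚ.*-identityˡ _ ⟨
      1 * countZeros M 1 u v
        ∎
    countZeros-lift (suc n) {u} {v} unimodular = begin
      ∑[ a < p * M ] countZeros (p * M) (suc n) v (+ a ℤ.* v - u)
        ≡⟨ ∑-cong (p * M) (λ a → countZeros-lift n (unimodular-step unimodular a)) ⟩
      ∑[ a < p * M ] (p ^ n * rest a)  ≡⟨ ∑-distribˡ (p * M) (p ^ n) rest ⟩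
      p ^ n * ∑ (p * M) rest           ≡⟨ cong (_*_ (p ^ n)) (∑-periodic p M rest periodic) ⟩
      p ^ n * (p * ∑ M rest)           ≡⟨ x∙yz≈yx∙z (p ^ n) p (∑ M rest) ⟩
      p * p ^ n * ∑ M rest             ∎
      where
      rest : ℕ → ℕ
      rest a = countZeros M (suc n) v (+ a ℤ.* v - u)
      periodic : ∀ t b → rest (t * M + b) ≡ rest b
      periodic t b = countZeros-cong M (suc n) (≡mod-refl v) (+ t ℤ.* v , block-shift t M b v u)

module _ (k : ℕ) where
  open ZMod k

  toℤ : Zn → ℤ
  toℤ a = + toℕ a

  toℤ-≡mod : ∀ {a m} → toℕ a ≡ m % suc k → toℤ a ≡ + m mod suc k
  toℤ-≡mod {a} {m} eq =
    subst (λ x → x ≡ + m mod suc k) (cong +_ (sym eq)) (%ℕ-≡mod (+ m) (suc k))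

  -- The left side is m mod suc k, spelled out because mod is taken by _≡_mod_.
  toℕ-mod : ∀ m → toℕ (Fin.fromℕ< (m%n<n m (suc k))) ≡ m % suc k
  toℕ-mod m = toℕ-fromℕ< (m%n<n m (suc k))

  toℕ-step : ∀ a u v → toℕ ((a *ₘ v) -ₘ u) ≡ (toℕ a * toℕ v + (suc k ∸ toℕ u)) % suc k
  toℕ-step a u v = begin
    toℕ ((a *ₘ v) +ₘ (-ₘ u))
      ≡⟨ toℕ-mod (toℕ (a *ₘ v) + toℕ (-ₘ u)) ⟩
    (toℕ (a *ₘ v) + toℕ (-ₘ u)) % suc k
      ≡⟨ cong₂ (λ x y → (x + y) % suc k) (toℕ-mod (toℕ a * toℕ v)) (toℕ-mod (suc k ∸ toℕ u)) ⟩
    ((toℕ a * toℕ v) % suc k + (suc k ∸ toℕ u) % suc k) % suc k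
      ≡⟨ %-distribˡ-+ (toℕ a * toℕ v) _ (suc k) ⟨
    (toℕ a * toℕ v + (suc k ∸ toℕ u)) % suc k
      ∎

  toℤ-step : ∀ a u v → toℤ ((a *ₘ v) -ₘ u) ≡ toℤ a ℤ.* toℤ v - toℤ u mod suc k
  toℤ-step a u v =
    ≡mod-trans {z = toℤ a ℤ.* toℤ v - toℤ u} (toℤ-≡mod (toℕ-step a u v)) (1ℤ , (begin
      + (toℕ a * toℕ v + (suc k ∸ toℕ u))          ≡⟨ ℤₚ.pos-+ (toℕ a * toℕ v) _ ⟩
      + (toℕ a * toℕ v) ℤ.+ + (suc k ∸ toℕ u)      ≡⟨ cong₂ ℤ._+_ (ℤₚ.pos-* (toℕ a) (toℕ v)) pos-∸ ⟩
      toℤ a ℤ.* toℤ v ℤ.+ (+ suc k - toℤ u)        ≡⟨ rearrange (toℤ a ℤ.* toℤ v) (toℤ u) (+ suc k) ⟩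
      toℤ a ℤ.* toℤ v - toℤ u ℤ.+ 1ℤ ℤ.* + suc k   ∎))
    where
    pos-∸ : + (suc k ∸ toℕ u) ≡ + suc k - toℤ u
    pos-∸ = trans (sym (ℤₚ.≤-⊖ (ℕₚ.<⇒≤ (toℕ<n u)))) (sym (ℤₚ.m-n≡m⊖n (suc k) (toℕ u)))
    rearrange : ∀ x u N → x ℤ.+ (N - u) ≡ x - u ℤ.+ 1ℤ ℤ.* N
    rearrange = solve-∀

  ≡0ₘ⇒∣ : ∀ {v} → v ≡ 0ₘ → + suc k ∣ toℤ v
  ≡0ₘ⇒∣ refl = divides 0ℤ refl

  ∣⇒≡0ₘ : ∀ {v} → + suc k ∣ toℤ v → v ≡ 0ₘ
  ∣⇒≡0ₘ {v} N∣v = toℕ-injective (∣∧<⇒≡0 (∣⇒∣ᵤ N∣v) (toℕ<n v))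

  #zeros-Kaux≡countZeros : ∀ n u v → length (filter (λ as → Kaux u v as Fin.≟ 0ₘ) (tuples n)) ≡
                                     countZeros (suc k) n (toℤ u) (toℤ v)
  #zeros-Kaux≡countZeros zero u v =
    trans (length-filter-∷ (λ as → Kaux u v as Fin.≟ 0ₘ) [] [])
          (trans (ℕₚ.+-identityʳ _) (𝟙-cong _ _ ≡0ₘ⇒∣ ∣⇒≡0ₘ))
  #zeros-Kaux≡countZeros (suc n) u v = begin
    length (filter P? (concatMap (λ a → map (a ∷_) (tuples n)) (allFin (suc k))))
      ≡⟨ length-filter-concatMap P? (λ a → map (a ∷_) (tuples n)) (allFin (suc k)) ⟩
    sum (map (λ a → length (filter P? (map (a ∷_) (tuples n)))) (allFin (suc k)))
      ≡⟨ cong sum (map-cong first-entry (allFin (suc k))) ⟩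
    sum (map (λ a → countZeros (suc k) n (toℤ v) (+ toℕ a ℤ.* toℤ v - toℤ u)) (allFin (suc k)))
      ≡⟨ sum-map-allFin (suc k) (λ a → countZeros (suc k) n (toℤ v) (+ a ℤ.* toℤ v - toℤ u)) ⟩
    countZeros (suc k) (suc n) (toℤ u) (toℤ v)
      ∎
    where
    P? : (as : Vec Zn (suc n)) → Dec (Kaux u v as ≡ 0ₘ)
    P? as = Kaux u v as Fin.≟ 0ₘ
    first-entry : ∀ a → length (filter P? (map (a ∷_) (tuples n))) ≡
                        countZeros (suc k) n (toℤ v) (+ toℕ a ℤ.* toℤ v - toℤ u)
    first-entry a = begin
      length (filter P? (map (a ∷_) (tuples n)))
        ≡⟨ length-filter-map P? (a ∷_) (tuples n) ⟩
      length (filter (P? ∘ (a ∷_)) (tuples n))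
        ≡⟨ #zeros-Kaux≡countZeros n v ((a *ₘ v) -ₘ u) ⟩
      countZeros (suc k) n (toℤ v) (toℤ ((a *ₘ v) -ₘ u))
        ≡⟨ countZeros-cong (suc k) n (≡mod-refl (toℤ v)) (toℤ-step a u v) ⟩
      countZeros (suc k) n (toℤ v) (toℤ a ℤ.* toℤ v - toℤ u)
        ∎

r≡countZeros : ∀ N .{{_ : NonZero N}} n → r n N ≡ countZeros N n 0ℤ 1ℤ
r≡countZeros (suc k) n =
  trans (#zeros-Kaux≡countZeros k n 0ₘ 1ₘ)
        (countZeros-cong (suc k) n (≡mod-refl 0ℤ) (toℤ-≡mod k (toℕ-mod k 1)))
  where open ZMod k using (0ₘ; 1ₘ)

lemma3p8 : (n m p : ℕ) → 1 ≤ n → 2 ≤ m → Prime p →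
    r n (p ^ m) ≡ p ^ (n ∸ 1) * r n (p ^ (m ∸ 1))
lemma3p8 (suc n) (suc (suc m)) p _ _ isPrime = begin
  r (suc n) (p * M)                   ≡⟨ r≡countZeros (p * M) (suc n) ⟩
  countZeros (p * M) (suc n) 0ℤ 1ℤ    ≡⟨ countZeros-lift isPrime (m∣m*n (p ^ m)) n
                                                          (unimodular-0-1 isPrime) ⟩
  p ^ n * countZeros M (suc n) 0ℤ 1ℤ  ≡⟨ cong (_*_ (p ^ n)) (r≡countZeros M (suc n)) ⟨
  p ^ n * r (suc n) M                 ∎
  where
  M : ℕ
  M = p ^ suc m
  instance
    p≢0 : NonZero p
    p≢0 = prime⇒nonZero isPrime
    M≢0 : NonZero M
    M≢0 = ℕₚ.m^n≢0 p (suc m)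
    pM≢0 : NonZero (p * M)
    pM≢0 = ℕₚ.m*n≢0 p M
lemma3p8 zero    _          _ () _        _
lemma3p8 (suc n) zero       _ _  ()       _
lemma3p8 (suc n) (suc zero) _ _  (s≤s ()) _
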